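{- Let $U\subseteq\mathbb N$ be an almost basic set. Then $U$ is open in the Kirch topology, and for every $n\geq 2$ and every set $\{x_1,\dots,x_n\}\subseteq U$ of $n$ distinct elements, the set $\langle x_1,\dots,x_n\rangle\cap U$ is infinite.
   Context: $\mathbb N=\{1,2,\dots\}$ and $\mathbb N_0=\{0,1,2,\dots\}$. The Kirch topology on $\mathbb N$ is the topology with basis consisting of all arithmetic progressions $a+d\mathbb N_0$ with $a,d\in\mathbb N$, $\gcd(a,d)=1$ and $d$ square-free. An arithmetic progression $a+d\mathbb N_0$ in $\mathbb N$ is full if it equals $(a+d\mathbb Z)\cap\mathbb N$. A basic set is a full arithmetic progression $a+d\mathbb N_0$ with $\gcd(a,d)=1$ and $d$ square-free. An almost basic set is a set obtained from a basic set by removing a Kirch-closed subset of natural density zero. For $X\subseteq\mathbb N$, the arithmetic convex closure $\langle X\rangle$ (written $\langle x_1,\dots,x_n\rangle$ for $X=\{x_1,\dots,x_n\}$) is the intersection of all full arithmetic progressions in $\mathbb N$ containing $X$. -}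

module Defs where

open import Data.Nat using (ℕ; _+_; _*_; _≤_; _<_)
open import Data.Nat.Divisibility using (_∣_)
open import Data.Nat.Coprimality using (Coprime)
open import Data.Nat.Primality using (Prime)
open import Data.Integer as ℤ using (ℤ; +_)
open import Data.List using (List; length)
open import Data.List.Membership.Propositional using (_∈_)
open import Data.List.Relation.Unary.All using (All)
open import Data.List.Relation.Unary.Unique.Propositional using (Unique)
open import Data.Product using (Σ; _×_; ∃; ∃-syntax)
open import Relation.Nullary using (¬_)
open import Relation.Binary.PropositionalEquality using (_≡_)

-- Subsets of ℕ are predicates on Agda's ℕ (which contains 0); the
-- paper's ℕ = {1,2,...} is handled by requiring positivity where needed.
Set⊆ℕ : Set₁
Set⊆ℕ = ℕ → Set

_⊆_ : Set⊆ℕ → Set⊆ℕ → Set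
A ⊆ B = ∀ x → A x → B x

AP : ℕ → ℕ → Set⊆ℕ
AP a d x = ∃[ k ] x ≡ a + d * k

Full : ℕ → ℕ → Set
Full a d = ∀ y → 1 ≤ y → (∃[ z ] (+ y) ≡ (+ a) ℤ.+ (+ d) ℤ.* z) → AP a d y

SquareFree : ℕ → Set
SquareFree d = ∀ p → Prime p → ¬ (p * p ∣ d)

KirchBasis : ℕ → ℕ → Set
KirchBasis a d = (1 ≤ a) × (1 ≤ d) × Coprime a d × SquareFree d

Basic : ℕ → ℕ → Set
Basic a d = KirchBasis a d × Full a d

KirchOpen : Set⊆ℕ → Set
KirchOpen U = (∀ x → U x → 1 ≤ x)
  × (∀ x → U x → ∃[ a ] ∃[ d ] KirchBasis a d × AP a d x × AP a d ⊆ U)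

KirchClosed : Set⊆ℕ → Set
KirchClosed C = (∀ x → C x → 1 ≤ x)
  × KirchOpen (λ x → (1 ≤ x) × ¬ C x)

-- natural density zero: for every k ≥ 1, eventually (for N ≥ N₀) every
-- list of distinct elements of C ∩ [1,N] has length ℓ with k·ℓ ≤ N,
-- i.e. |C ∩ [1,N]| / N ≤ 1/k
DensityZero : Set⊆ℕ → Set
DensityZero C = ∀ k → 1 ≤ k → ∃[ N₀ ] ∀ N → N₀ ≤ N →
  ∀ (xs : List ℕ) → Unique xs → All (λ x → C x × x ≤ N) xs →
  k * length xs ≤ N

AlmostBasic : Set⊆ℕ → Set₁
AlmostBasic U = ∃[ a ] ∃[ d ] Basic a d × Σ Set⊆ℕ λ C →
  C ⊆ AP a d × KirchClosed C × DensityZero C ×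
  (∀ x → (U x → AP a d x × ¬ C x) × (AP a d x × ¬ C x → U x))

Hull : Set⊆ℕ → Set⊆ℕ
Hull X y = ∀ a d → 1 ≤ a → 1 ≤ d → Full a d → X ⊆ AP a d → AP a d y

Infinite : Set⊆ℕ → Set
Infinite S = ¬ (∃[ ys ] (∀ x → S x → x ∈ ys))

-- The almost basic set U is the basic open set a + dℕ₀ intersected with the open
-- complement of C, and the Kirch basis is closed under meets at a common point (the
-- modulus lcm(d, d′) is square-free and coprime to the point), so U is open.
-- For u < v in the list with u ∈ U, every progression through u and v contains
-- u + (v − u)ℕ₀; hence u + (v − u)dℕ₀ lies both in the hull and in a + dℕ₀. If the hull
-- met U in a finite set, every term of this progression beyond some bound would
-- (up to double negation) lie in C, which a set of density zero cannot accommodate.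
module Submission where

open import Defs
open import Data.Nat using (ℕ; suc; _+_; _*_; _∸_; _≤_; _<_; z≤n; s≤s; NonZero; >-nonZero; >-nonZero⁻¹)
open import Data.Nat.Properties
open import Data.Nat.Divisibility
open import Data.Nat.Coprimality using (Coprime; coprime-divisor)
open import Data.Nat.Primality using (Prime; euclidsLemma; prime⇒nonZero)
open import Data.Nat.GCD using (gcd; gcd[m,n]∣m; gcd[m,n]∣n; gcd-greatest)
open import Data.Nat.Tactic.RingSolver using (solve)
open import Data.List using (List; []; _∷_; length; applyUpTo)
open import Data.List.Properties using (length-applyUpTo)
open import Data.List.Extrema.Nat using (max; xs≤max)
open import Data.List.Membership.Propositional using (_∈_)
open import Data.List.Relation.Unary.Any using (here; there)
open import Data.List.Relation.Unary.All as All using (All)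
import Data.List.Relation.Unary.All.Properties as All
import Data.List.Relation.Unary.AllPairs as AllPairs
open import Data.List.Relation.Unary.Unique.Propositional using (Unique)
import Data.List.Relation.Unary.Unique.Propositional.Properties as Unique
open import Data.Product using (_×_; _,_; proj₁; proj₂; ∃-syntax)
open import Data.Sum using (inj₁; inj₂)
open import Level using (0ℓ)
open import Relation.Nullary using (¬_; yes; no; contradiction)
open import Relation.Nullary.Negation using (¬¬-Monad; ¬¬-map)
open import Relation.Unary using (_∩_)
open import Relation.Binary.Definitions using (tri<; tri≈; tri>)
open import Relation.Binary.PropositionalEquality using (_≡_; refl; sym; trans; cong; subst)

AP-start : ∀ a d → AP a d a
AP-start a d = 0 , sym (trans (cong (a +_) (*-zeroʳ d)) (+-identityʳ a))

AP-pos : ∀ {a d x} → 1 ≤ a → AP a d x → 1 ≤ x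
AP-pos {a} {d} 1≤a (k , refl) = ≤-trans 1≤a (m≤m+n a (d * k))

AP-⊆ : ∀ {a d x m} → AP a d x → d ∣ m → AP x m ⊆ AP a d
AP-⊆ {a} {d} (k , refl) (divides-refl q) _ (j , refl) =
  k + q * j , solve (a ∷ d ∷ k ∷ q ∷ j ∷ [])

AP-stride : ∀ {a d u v} → AP a d u → AP a d v → AP u (v ∸ u) ⊆ AP a d
AP-stride {a} {d} (k , refl) (l , refl) = AP-⊆ (k , refl) (divides (l ∸ k) v∸u≡)
  where
  v∸u≡ : a + d * l ∸ (a + d * k) ≡ (l ∸ k) * d
  v∸u≡ = trans ([m+n]∸[m+o]≡n∸o a (d * l) (d * k))
               (trans (sym (*-distribˡ-∸ d l k)) (*-comm d (l ∸ k)))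

coprime-AP : ∀ {a d x} → Coprime a d → AP a d x → Coprime x d
coprime-AP {a} {d} cop (k , refl) {i} (i∣x , i∣d) =
  cop (∣m+n∣m⇒∣n (subst (i ∣_) (+-comm a (d * k)) i∣x) (∣-trans i∣d (m∣m*n k)) , i∣d)

coprime-∣ʳ : ∀ {x d e} → Coprime x d → e ∣ d → Coprime x e
coprime-∣ʳ cop e∣d (i∣x , i∣e) = cop (i∣x , ∣-trans i∣e e∣d)

coprime-*ʳ : ∀ {x d e} → Coprime x d → Coprime x e → Coprime x (d * e)
coprime-*ʳ {x} {d} cop-d cop-e {i} (i∣x , i∣de) =
  cop-e (i∣x , coprime-divisor (λ (j∣i , j∣d) → cop-d (∣-trans j∣i i∣x , j∣d)) i∣de)

prime∤ˡ-∣* : ∀ {p m n} → Prime p → ¬ p ∣ m → p ∣ m * n → p ∣ n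
prime∤ˡ-∣* {m = m} {n} pp p∤m p∣mn with euclidsLemma m n pp p∣mn
... | inj₁ p∣m = contradiction p∣m p∤m
... | inj₂ p∣n = p∣n

prime∤ˡ-sq∣* : ∀ {p m n} → Prime p → ¬ p ∣ m → p * p ∣ m * n → p * p ∣ n
prime∤ˡ-sq∣* {p} {m} pp p∤m pp∣mn with prime∤ˡ-∣* pp p∤m (∣-trans (m∣m*n p) pp∣mn)
... | divides-refl q = *-pres-∣ p∣q ∣-refl
  where
  instance _ = prime⇒nonZero pp
  p∣q : p ∣ q
  p∣q = prime∤ˡ-∣* pp p∤m (*-cancelˡ-∣ p (subst (p * p ∣_) rearrange pp∣mn))
    where
    rearrange : m * (q * p) ≡ p * (m * q)
    rearrange = solve (m ∷ q ∷ p ∷ [])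

sq∤ˡ-∣* : ∀ {p m n} → Prime p → ¬ p * p ∣ m → p * p ∣ m * n → p ∣ n
sq∤ˡ-∣* {p} {m} {n} pp pp∤m pp∣mn with p ∣? m
... | no p∤m = ∣-trans (m∣m*n p) (prime∤ˡ-sq∣* pp p∤m pp∣mn)
... | yes (divides-refl m₁) = prime∤ˡ-∣* pp p∤m₁ (*-cancelˡ-∣ p p*p∣p*m₁n)
  where
  instance _ = prime⇒nonZero pp
  p∤m₁ : ¬ p ∣ m₁
  p∤m₁ p∣m₁ = pp∤m (*-pres-∣ p∣m₁ ∣-refl)
  rearrange : m₁ * p * n ≡ p * (m₁ * n)
  rearrange = solve (m₁ ∷ p ∷ n ∷ [])
  p*p∣p*m₁n : p * p ∣ p * (m₁ * n)
  p*p∣p*m₁n = subst (p * p ∣_) rearrange pp∣mn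

squareFree-* : ∀ {d e g} → SquareFree d → SquareFree (e * g) →
  (∀ {p} → p ∣ d → p ∣ e → p ∣ g) → SquareFree (d * e)
squareFree-* {d} {e} {g} sf-d sf-eg shared p pp pp∣de with p ∣? d
... | no p∤d = sf-eg p pp (∣-trans (prime∤ˡ-sq∣* pp p∤d pp∣de) (m∣m*n g))
... | yes p∣d = sf-eg p pp (*-pres-∣ p∣e (shared p∣d p∣e))
  where
  p∣e : p ∣ e
  p∣e = sq∤ˡ-∣* pp (sf-d p pp) pp∣de

-- The meet has modulus d * (d′ / gcd d d′) = lcm d d′.
kirchBasis-∩ : ∀ {a d a′ d′ x} → KirchBasis a d → KirchBasis a′ d′ →
  AP a d x → AP a′ d′ x →
  ∃[ m ] KirchBasis x m × AP x m ⊆ AP a d × AP x m ⊆ AP a′ d′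
kirchBasis-∩ {a} {d} {a′} {d′} {x} (1≤a , 1≤d , cop , sf) (_ , 1≤d′ , cop′ , sf′) x∈ x∈′ =
  d * e , (AP-pos {a} {d} 1≤a x∈ , 1≤de , coprime , squareFree) ,
  AP-⊆ {a} {d} x∈ (m∣m*n e) , AP-⊆ {a′} {d′} x∈′ d′∣de
  where
  g e : ℕ
  g = gcd d d′
  e = quotient (gcd[m,n]∣n d d′)
  d′≡e*g : d′ ≡ e * g
  d′≡e*g = _∣_.equality (gcd[m,n]∣n d d′)
  d′≡g*e : d′ ≡ g * e
  d′≡g*e = trans d′≡e*g (*-comm e g)
  e∣d′ : e ∣ d′
  e∣d′ = divides g d′≡g*e
  d′∣de : d′ ∣ d * e
  d′∣de = subst (_∣ d * e) (sym d′≡g*e) (*-pres-∣ (gcd[m,n]∣m d d′) ∣-refl)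
  1≤e : 1 ≤ e
  1≤e = >-nonZero⁻¹ e {{m*n≢0⇒m≢0 e {{subst NonZero d′≡e*g (>-nonZero 1≤d′)}}}}
  1≤de : 1 ≤ d * e
  1≤de = *-mono-≤ 1≤d 1≤e
  coprime : Coprime x (d * e)
  coprime = coprime-*ʳ (coprime-AP {a} cop x∈) (coprime-∣ʳ (coprime-AP {a′} cop′ x∈′) e∣d′)
  squareFree : SquareFree (d * e)
  squareFree = squareFree-* sf (subst SquareFree d′≡e*g sf′)
    (λ p∣d p∣e → gcd-greatest p∣d (∣-trans p∣e e∣d′))

kirchOpen-AP : ∀ {a d} → KirchBasis a d → KirchOpen (AP a d)
kirchOpen-AP {a} {d} B =
  (λ _ → AP-pos {a} {d} (proj₁ B)) , λ _ x∈ → a , d , B , x∈ , λ _ y∈ → y∈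

kirchOpen-∩ : ∀ {U V} → KirchOpen U → KirchOpen V → KirchOpen (U ∩ V)
kirchOpen-∩ {U} {V} (U-pos , U-nbhd) (_ , V-nbhd) = (λ x (Ux , _) → U-pos x Ux) , nbhd
  where
  nbhd : ∀ x → (U ∩ V) x → ∃[ a ] ∃[ d ] KirchBasis a d × AP a d x × AP a d ⊆ (U ∩ V)
  nbhd x (Ux , Vx) with U-nbhd x Ux | V-nbhd x Vx
  ... | a , d , B , x∈ , ⊆U | a′ , d′ , B′ , x∈′ , ⊆V
    with kirchBasis-∩ {a} {d} {a′} {d′} B B′ x∈ x∈′
  ... | m , B∩ , ⊆AP , ⊆AP′ =
    x , m , B∩ , AP-start x m , λ y y∈ → ⊆U y (⊆AP y y∈) , ⊆V y (⊆AP′ y y∈)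

kirchOpen-resp : ∀ {U V} → U ⊆ V → V ⊆ U → KirchOpen V → KirchOpen U
kirchOpen-resp {U} U⊆V V⊆U (V-pos , V-nbhd) = (λ x Ux → V-pos x (U⊆V x Ux)) , nbhd
  where
  nbhd : ∀ x → U x → ∃[ a ] ∃[ d ] KirchBasis a d × AP a d x × AP a d ⊆ U
  nbhd x Ux with V-nbhd x (U⊆V x Ux)
  ... | a , d , B , x∈ , ⊆V = a , d , B , x∈ , λ y y∈ → V⊆U y (⊆V y y∈)

almostBasic⇒kirchOpen : ∀ {U} → AlmostBasic U → KirchOpen U
almostBasic⇒kirchOpen {U} (a , d , (B , _) , C , _ , (_ , C-coopen) , _ , U⇔) =
  kirchOpen-resp U⊆ ⊆U (kirchOpen-∩ (kirchOpen-AP B) C-coopen)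
  where
  U⊆ : U ⊆ (AP a d ∩ λ x → 1 ≤ x × ¬ C x)
  U⊆ x Ux with proj₁ (U⇔ x) Ux
  ... | x∈ , x∉C = x∈ , AP-pos {a} {d} (proj₁ B) x∈ , x∉C
  ⊆U : (AP a d ∩ λ x → 1 ≤ x × ¬ C x) ⊆ U
  ⊆U x (x∈ , _ , x∉C) = proj₂ (U⇔ x) (x∈ , x∉C)

unbounded⇒infinite : ∀ {S} → (∀ n → ¬ ¬ (∃[ y ] n < y × S y)) → Infinite S
unbounded⇒infinite unbounded (ys , S⊆ys) = unbounded (max 0 ys) λ (y , max<y , Sy) →
  <⇒≱ max<y (All.lookup (xs≤max 0 ys) (S⊆ys y Sy))

-- Density zero is applied with k = L + 1 to the first n = N₀ + b + 1 terms b + L i,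
-- all of which lie below N = b + L n; this would force (L + 1) n ≤ b + L n.
densityZero⇒AP⊈ : ∀ {C L} → DensityZero C → 1 ≤ L → ∀ b → ¬ (∀ t → ¬ ¬ C (b + L * t))
densityZero⇒AP⊈ {C} {L} dz 1≤L b AP⊆C with dz (suc L) (s≤s z≤n)
... | N₀ , bound = ¬¬terms∈C λ terms∈C → n≰b (counted (bound N N₀≤N terms unique terms∈C))
  where
  instance _ = >-nonZero 1≤L
  n N : ℕ
  n = suc (N₀ + b)
  N = b + L * n
  term : ℕ → ℕ
  term i = b + L * i
  terms : List ℕ
  terms = applyUpTo term n
  unique : Unique terms
  unique = Unique.applyUpTo⁺₁ term n λ {i} {j} i<j _ eq →
    <⇒≢ i<j (*-cancelˡ-≡ i j L (+-cancelˡ-≡ b (L * i) (L * j) eq))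
  ¬¬terms∈C : ¬ ¬ All (λ y → C y × y ≤ N) terms
  ¬¬terms∈C = All.sequenceM 0ℓ ¬¬-Monad (All.applyUpTo⁺₁ term n λ {i} i<n →
    ¬¬-map (_, +-monoʳ-≤ b (*-monoʳ-≤ L (<⇒≤ i<n))) (AP⊆C i))
  N₀≤N : N₀ ≤ N
  N₀≤N = ≤-trans (≤-trans (m≤m+n N₀ b) (n≤1+n _)) (≤-trans (m≤n*m n L) (m≤n+m (L * n) b))
  counted : suc L * length terms ≤ N → n ≤ b
  counted le = +-cancelʳ-≤ (L * n) n b (subst (λ ℓ → suc L * ℓ ≤ N) (length-applyUpTo term n) le)
  n≰b : ¬ n ≤ b
  n≰b n≤b = <⇒≱ (s≤s (m≤n+m b N₀)) n≤b

densityZero-AP∖⇒infinite : ∀ {C S u L} → DensityZero C → 1 ≤ L →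
  (∀ y → AP u L y → ¬ C y → S y) → Infinite S
densityZero-AP∖⇒infinite {u = u} {L} dz 1≤L AP∖C⊆S = unbounded⇒infinite λ n nothing-above →
  densityZero⇒AP⊈ dz 1≤L (u + L * suc n) λ t t∉C →
    nothing-above (_ , n<term n t , AP∖C⊆S _ (term∈AP n t) t∉C)
  where
  instance _ = >-nonZero 1≤L
  n<term : ∀ n t → n < u + L * suc n + L * t
  n<term n t = ≤-trans (m≤n*m (suc n) L) (≤-trans (m≤n+m _ u) (m≤m+n _ (L * t)))
  term∈AP : ∀ n t → AP u L (u + L * suc n + L * t)
  term∈AP n t = AP-⊆ {u} {L} (suc n , refl) ∣-refl _ (t , refl)

AP-stride⊆Hull : ∀ {xs u v} → u ∈ xs → v ∈ xs → AP u (v ∸ u) ⊆ Hull (_∈ xs)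
AP-stride⊆Hull u∈ v∈ y y∈ a d _ _ _ xs⊆AP = AP-stride {a} {d} (xs⊆AP _ u∈) (xs⊆AP _ v∈) y y∈

almostBasic∩hull-infinite : ∀ {U xs u v} → AlmostBasic U → u ∈ xs → v ∈ xs → u < v → U u →
  Infinite (λ y → Hull (_∈ xs) y × U y)
almostBasic∩hull-infinite {u = u} {v} (a , d , ((_ , 1≤d , _) , _) , C , _ , _ , dz , U⇔)
                          u∈ v∈ u<v Uu =
  densityZero-AP∖⇒infinite dz 1≤L λ y y∈ y∉C →
    AP-stride⊆Hull u∈ v∈ y (AP-⊆ {u} {v ∸ u} (AP-start u (v ∸ u)) (m∣m*n d) y y∈) ,
    proj₂ (U⇔ y) (AP-⊆ {a} {d} (proj₁ (proj₁ (U⇔ u) Uu)) (n∣m*n (v ∸ u)) y y∈ , y∉C)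
  where
  1≤L : 1 ≤ (v ∸ u) * d
  1≤L = *-mono-≤ (m<n⇒0<n∸m u<v) 1≤d

unique⇒∃< : ∀ {xs : List ℕ} → 2 ≤ length xs → Unique xs → ∃[ u ] ∃[ v ] u ∈ xs × v ∈ xs × u < v
unique⇒∃< {x ∷ y ∷ _} _ ((x≢y All.∷ _) AllPairs.∷ _) with <-cmp x y
... | tri< x<y _ _ = x , y , here refl , there (here refl) , x<y
... | tri≈ _ x≡y _ = contradiction x≡y x≢y
... | tri> _ _ y<x = y , x , there (here refl) , here refl , y<x
unique⇒∃< {_ ∷ []} (s≤s ()) _

mainTheorem1 : (U : Set⊆ℕ) → AlmostBasic U →
    KirchOpen U ×
    ((xs : List ℕ) → 2 ≤ length xs → Unique xs → All U xs →
      Infinite (λ y → Hull (λ z → z ∈ xs) y × U y))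
mainTheorem1 U almostBasic = almostBasic⇒kirchOpen almostBasic , hull∩U-infinite
  where
  hull∩U-infinite : (xs : List ℕ) → 2 ≤ length xs → Unique xs → All U xs →
    Infinite (λ y → Hull (λ z → z ∈ xs) y × U y)
  hull∩U-infinite xs 2≤length unique xs⊆U with unique⇒∃< 2≤length unique
  ... | u , v , u∈ , v∈ , u<v = almostBasic∩hull-infinite almostBasic u∈ v∈ u<v (All.lookup xs⊆U u∈)
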